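{- Let $p\ge 2$ and let $cit_1\ge cit_2\ge\dots\ge cit_p\ge 1$ be integers. For $k\in\{0,1,\dots,p-1\}$ let $h_k$ be the $h$-index of the sequence $cit_{k+1},\dots,cit_p$ (i.e. $h_k=\max\{m\ge1: cit_{k+m}\ge m,\ k+m\le p\}$), let $N_h^{(k)}=\sum_{j=k+1}^{k+h_k} cit_j$, and let $e_k=\sqrt{N_h^{(k)}-h_k^2}$. Then for each $k\in\{0,1,\dots,p-2\}$ the following hold: (i) if $h_{k+1}=h_k$, then $e_k\ge e_{k+1}$; (ii) if $h_{k+1}=h_k-1$ and $cit_{k+1}\ge 2h_k-1$, then $e_k\ge e_{k+1}$; (iii) if $h_{k+1}=h_k-1$ and $cit_{k+1}<2h_k-1$, then $e_k<e_{k+1}$.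
   Context: The numbers $cit_1,\dots,cit_p$ are the citation counts of a researcher's publications ranked in non-increasing order. $h_k$ is called the shifted $h$-index of order $k$ ($h_0$ is the usual $h$-index); $N_h^{(k)}$ is the total number of citations in the $h_k$-core of the shifted sequence, and $e_k$ is the corresponding shifted $e$-index (the square root is of a non-negative quantity since each of $cit_{k+1},\dots,cit_{k+h_k}$ is at least $h_k$). -}

module Defs where

open import Data.Nat using (ℕ; zero; suc; _+_; _*_; _∸_; _≤?_)
open import Relation.Nullary using (yes; no)

-- A citation record: cit i is the citation count of the i-th paper (1-based,
-- only indices 1..p are meaningful).

hSearch : (ℕ → ℕ) → ℕ → ℕ → ℕ
hSearch cit k zero = zero
hSearch cit k (suc m) with suc m ≤? cit (k + suc m)
... | yes _ = suc m
... | no  _ = hSearch cit k m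

hShift : (ℕ → ℕ) → ℕ → ℕ → ℕ
hShift cit p k = hSearch cit k (p ∸ k)

sumFrom : (ℕ → ℕ) → ℕ → ℕ → ℕ
sumFrom cit k zero = zero
sumFrom cit k (suc n) = sumFrom cit k n + cit (k + suc n)

Nh : (ℕ → ℕ) → ℕ → ℕ → ℕ
Nh cit p k = sumFrom cit k (hShift cit p k)

-- e_k² = N_h^(k) - h_k²  (non-negative by the context, so ∸ is exact here)
eSq : (ℕ → ℕ) → ℕ → ℕ → ℕ
eSq cit p k = Nh cit p k ∸ hShift cit p k * hShift cit p k

module Submission where

-- Every paper of the h_k-core of the shifted record has at least h_k citations, so h_k² ≤ N_h^(k)
-- and e_k² is an honest difference. Going from k to k + 1 slides the core window by one paper:
-- cit(k+1) leaves it, and if h stays the same then cit(k+1+h) ≤ cit(k+1) enters, so N_h cannot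
-- grow. If instead h drops from m+1 to m, the window just loses cit(k+1), and comparing squares
-- gives cit(k+1) + e_{k+1}² = (2(m+1) − 1) + e_k²; the sign of cit(k+1) − (2h_k − 1) decides.

open import Defs
open import Data.Nat
  using (ℕ; zero; suc; _+_; _*_; _∸_; _≤_; _<_; _≤′_; ≤′-refl; ≤′-step; z≤n; s≤s; _≤?_)
open import Data.Nat.Properties
open import Data.Nat.Tactic.RingSolver using (solve-∀)
open import Data.Product using (_×_; _,_)
open import Relation.Binary.PropositionalEquality
open import Relation.Nullary using (yes; no)

hSearch-≤ : ∀ cit k n → hSearch cit k n ≤ n
hSearch-≤ cit k zero = z≤n
hSearch-≤ cit k (suc m) with suc m ≤? cit (k + suc m)
... | yes _ = ≤-refl
... | no  _ = m≤n⇒m≤1+n (hSearch-≤ cit k m)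

hSearch-cited : ∀ cit k n → 1 ≤ hSearch cit k n → hSearch cit k n ≤ cit (k + hSearch cit k n)
hSearch-cited cit k (suc m) h≥1 with suc m ≤? cit (k + suc m)
... | yes m+1≤cit = m+1≤cit
... | no  _       = hSearch-cited cit k m h≥1

hShift-≤ : ∀ cit {p k} → k ≤ p → k + hShift cit p k ≤ p
hShift-≤ cit {p} {k} k≤p = begin
  k + hShift cit p k ≤⟨ +-monoʳ-≤ k (hSearch-≤ cit k (p ∸ k)) ⟩
  k + (p ∸ k)        ≡⟨ m+[n∸m]≡n k≤p ⟩
  p                  ∎
  where open ≤-Reasoning

sumFrom-≥ : ∀ cit k n c → (∀ i → 1 ≤ i → i ≤ n → c ≤ cit (k + i)) → n * c ≤ sumFrom cit k n
sumFrom-≥ cit k zero    c bound = z≤n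
sumFrom-≥ cit k (suc n) c bound = begin
  c + n * c                         ≡⟨ +-comm c (n * c) ⟩
  n * c + c                         ≤⟨ +-mono-≤ below-n (bound (suc n) (s≤s z≤n) ≤-refl) ⟩
  sumFrom cit k n + cit (k + suc n) ∎
  where
  open ≤-Reasoning
  below-n : n * c ≤ sumFrom cit k n
  below-n = sumFrom-≥ cit k n c (λ i i≥1 i≤n → bound i i≥1 (m≤n⇒m≤1+n i≤n))

sumFrom-cons : ∀ cit k n → cit (suc k) + sumFrom cit (suc k) n ≡ sumFrom cit k (suc n)
sumFrom-cons cit k zero    = trans (+-identityʳ _) (cong cit (+-comm 1 k))
sumFrom-cons cit k (suc n) = begin
  cit (suc k) + (sumFrom cit (suc k) n + cit (suc k + suc n))
    ≡⟨ sym (+-assoc (cit (suc k)) _ _) ⟩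
  cit (suc k) + sumFrom cit (suc k) n + cit (suc k + suc n)
    ≡⟨ cong₂ _+_ (sumFrom-cons cit k n) (cong cit (sym (+-suc k (suc n)))) ⟩
  sumFrom cit k (suc n) + cit (k + suc (suc n)) ∎
  where open ≡-Reasoning

sumFrom-slide-≤ : ∀ cit k n → cit (k + suc n) ≤ cit (suc k) → sumFrom cit (suc k) n ≤ sumFrom cit k n
sumFrom-slide-≤ cit k n new≤old = +-cancelˡ-≤ (cit (suc k)) _ _ (begin
  cit (suc k) + sumFrom cit (suc k) n ≡⟨ sumFrom-cons cit k n ⟩
  sumFrom cit k n + cit (k + suc n)   ≤⟨ +-monoʳ-≤ (sumFrom cit k n) new≤old ⟩
  sumFrom cit k n + cit (suc k)       ≡⟨ +-comm (sumFrom cit k n) _ ⟩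
  cit (suc k) + sumFrom cit k n       ∎)
  where open ≤-Reasoning

[1+m]²≡m²+[2[1+m]∸1] : ∀ m → suc m * suc m ≡ m * m + (2 * suc m ∸ 1)
[1+m]²≡m²+[2[1+m]∸1] m = trans (square m) (cong (m * m +_) (sym (+-suc m (m + 0))))
  where
  square : ∀ m → suc m * suc m ≡ m * m + suc (m + (m + 0))
  square = solve-∀

c+[x∸s]≡d+[c+x∸[s+d]] : ∀ c d s x → s ≤ x → s + d ≤ c + x → c + (x ∸ s) ≡ d + (c + x ∸ (s + d))
c+[x∸s]≡d+[c+x∸[s+d]] c d s x s≤x s+d≤c+x = +-cancelˡ-≡ s _ _ (begin
  s + (c + (x ∸ s))           ≡⟨ +-comm s _ ⟩
  c + (x ∸ s) + s             ≡⟨ +-assoc c _ s ⟩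
  c + (x ∸ s + s)             ≡⟨ cong (c +_) (m∸n+n≡m s≤x) ⟩
  c + x                       ≡⟨ sym (m+[n∸m]≡n s+d≤c+x) ⟩
  s + d + (c + x ∸ (s + d))   ≡⟨ +-assoc s d _ ⟩
  s + (d + (c + x ∸ (s + d))) ∎)
  where open ≡-Reasoning

+-compensate-≤ : ∀ {a b x y} → a + x ≡ b + y → b ≤ a → x ≤ y
+-compensate-≤ {b = b} {x} {y} eq b≤a =
  +-cancelˡ-≤ b x y (≤-trans (+-monoˡ-≤ x b≤a) (≤-reflexive eq))

+-compensate-< : ∀ {a b x y} → a + x ≡ b + y → a < b → y < x
+-compensate-< {b = b} {x} {y} eq a<b =
  +-cancelˡ-< b y x (≤-trans (s≤s (≤-reflexive (sym eq))) (+-monoˡ-≤ x a<b))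

module Descending (p : ℕ) (cit : ℕ → ℕ)
                  (descending : ∀ i → 1 ≤ i → i < p → cit (suc i) ≤ cit i) where

  cit-antitone : ∀ {i j} → 1 ≤ i → i ≤′ j → j ≤ p → cit j ≤ cit i
  cit-antitone _   ≤′-refl           _   = ≤-refl
  cit-antitone i≥1 (≤′-step {j} i≤j) j<p =
    ≤-trans (descending j (≤-trans i≥1 (≤′⇒≤ i≤j)) j<p)
            (cit-antitone i≥1 i≤j (<⇒≤ j<p))

  hShift²≤Nh : ∀ {k} → k ≤ p → hShift cit p k * hShift cit p k ≤ Nh cit p k
  hShift²≤Nh {k} k≤p = sumFrom-≥ cit k h h core
    where
    h = hShift cit p k
    core : ∀ i → 1 ≤ i → i ≤ h → h ≤ cit (k + i)
    core i i≥1 i≤h =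
      ≤-trans (hSearch-cited cit k (p ∸ k) (≤-trans i≥1 i≤h))
              (cit-antitone (≤-trans i≥1 (m≤n+m i k)) (≤⇒≤′ (+-monoʳ-≤ k i≤h)) (hShift-≤ cit k≤p))

  hShift≡⇒square≤sumFrom : ∀ {k h} → k ≤ p → hShift cit p k ≡ h → h * h ≤ sumFrom cit k h
  hShift≡⇒square≤sumFrom k≤p refl = hShift²≤Nh k≤p

  hShift≡⇒eSq≡ : ∀ {k h} → hShift cit p k ≡ h → eSq cit p k ≡ sumFrom cit k h ∸ h * h
  hShift≡⇒eSq≡ {k} = cong (λ h → sumFrom cit k h ∸ h * h)

  eSq-same-h : ∀ {k} → suc k ≤ p → hShift cit p (suc k) ≡ hShift cit p k → eSq cit p (suc k) ≤ eSq cit p k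
  eSq-same-h {k} k<p same = begin
    sumFrom cit (suc k) h ∸ h * h ≤⟨ ∸-monoˡ-≤ (h * h) (sumFrom-slide-≤ cit k h new≤old) ⟩
    sumFrom cit k h ∸ h * h       ≡⟨ sym (hShift≡⇒eSq≡ (sym same)) ⟩
    eSq cit p k                   ∎
    where
    open ≤-Reasoning
    h = hShift cit p (suc k)
    new≤old : cit (k + suc h) ≤ cit (suc k)
    new≤old = cit-antitone (s≤s z≤n) (≤⇒≤′ (≤-trans (s≤s (m≤m+n k h)) (≤-reflexive (sym (+-suc k h)))))
                           (subst (_≤ p) (sym (+-suc k h)) (hShift-≤ cit k<p))

  eSq-drop-h : ∀ {k m} → suc k ≤ p → hShift cit p k ≡ suc m → hShift cit p (suc k) ≡ m
             → cit (suc k) + eSq cit p (suc k) ≡ (2 * suc m ∸ 1) + eSq cit p k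
  eSq-drop-h {k} {m} k<p hk hk+1 = begin
    cit (suc k) + eSq cit p (suc k) ≡⟨ cong (cit (suc k) +_) (hShift≡⇒eSq≡ hk+1) ⟩
    c + (x ∸ m * m)                 ≡⟨ c+[x∸s]≡d+[c+x∸[s+d]] c d (m * m) x
                                        (hShift≡⇒square≤sumFrom k<p hk+1) square≤c+x ⟩
    d + (c + x ∸ (m * m + d))       ≡⟨ cong (d +_) (sym e≡) ⟩
    d + eSq cit p k                 ∎
    where
    open ≡-Reasoning
    c = cit (suc k)
    d = 2 * suc m ∸ 1
    x = sumFrom cit (suc k) m
    N≡ : sumFrom cit k (suc m) ≡ c + x
    N≡ = sym (sumFrom-cons cit k m)
    square≤c+x : m * m + d ≤ c + x
    square≤c+x = subst₂ _≤_ ([1+m]²≡m²+[2[1+m]∸1] m) N≡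
                        (hShift≡⇒square≤sumFrom (<⇒≤ k<p) hk)
    e≡ : eSq cit p k ≡ c + x ∸ (m * m + d)
    e≡ = trans (hShift≡⇒eSq≡ hk) (cong₂ _∸_ N≡ ([1+m]²≡m²+[2[1+m]∸1] m))

proposition4p8 : (p : ℕ) → (cit : ℕ → ℕ) → 2 ≤ p
    → (∀ i → 1 ≤ i → i < p → cit (suc i) ≤ cit i)
    → (∀ i → 1 ≤ i → i ≤ p → 1 ≤ cit i)
    → (k : ℕ) → k + 2 ≤ p
    → (hShift cit p (suc k) ≡ hShift cit p k → eSq cit p (suc k) ≤ eSq cit p k)
      × (hShift cit p (suc k) ≡ hShift cit p k ∸ 1 → 2 * hShift cit p k ∸ 1 ≤ cit (suc k) → eSq cit p (suc k) ≤ eSq cit p k)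
      × (hShift cit p (suc k) ≡ hShift cit p k ∸ 1 → cit (suc k) < 2 * hShift cit p k ∸ 1 → eSq cit p k < eSq cit p (suc k))
proposition4p8 p cit _ descending _ k k+2≤p =
  eSq-same-h k<p , drop-cited (hShift cit p k) refl , drop-uncited (hShift cit p k) refl
  where
  open Descending p cit descending
  k<p : suc k ≤ p
  k<p = <⇒≤ (subst (_≤ p) (+-comm k 2) k+2≤p)

  drop-cited : ∀ h → hShift cit p k ≡ h → hShift cit p (suc k) ≡ h ∸ 1 → 2 * h ∸ 1 ≤ cit (suc k)
             → eSq cit p (suc k) ≤ eSq cit p k
  -- With h_k = 0, truncated subtraction turns the drop h_k ∸ 1 into no change at all.
  drop-cited zero    hk drop _     = eSq-same-h k<p (trans drop (sym hk))
  drop-cited (suc m) hk drop cited = +-compensate-≤ (eSq-drop-h k<p hk drop) cited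

  drop-uncited : ∀ h → hShift cit p k ≡ h → hShift cit p (suc k) ≡ h ∸ 1 → cit (suc k) < 2 * h ∸ 1
               → eSq cit p k < eSq cit p (suc k)
  drop-uncited zero    _  _    ()
  drop-uncited (suc m) hk drop uncited = +-compensate-< (eSq-drop-h k<p hk drop) uncited
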